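{- Let $n$ and $D$ be positive integers. Let $G=G(V_1,V_2)$ be a bipartite graph, let $F$ be an $(n,D)$-bipartite graph, and suppose that $\phi: F\hookrightarrow G$ is an $(n,D)$-good embedding. Assume that $F'$ is obtained from $F$ by successively deleting vertices of degree at most one. Then the restriction of $\phi$ to $F'$ is also an $(n,D)$-good embedding.
   Context: An $(n,D)$-bipartite graph is a graph with a bipartition $(X_1,X_2)$ such that $|X_i|\le n$ and every vertex of $X_i$ has degree at most $D$, for $i\in\{1,2\}$. For a bipartite graph $G=G(V_1,V_2)$ and $X\subseteq V(G)$, $N_G(X)=\bigcup_{x\in X}N_G(x)$. An embedding $\phi:F\hookrightarrow G$ of a bipartite graph $F$ into $G$ (an injective map on vertices sending edges to edges) is $(n,D)$-good if for each $i\in\{1,2\}$ and every $X\subseteq V_i$ with $|X|\le n$, \[ |N_G(X)\setminus \phi(F)|\ \ge\ \sum_{v\in X}\big(D-\deg_F(\phi^{ -1}(v))\big)+|\phi(F)\cap X|, \] where $\phi(F)$ denotes the image vertex set of $\phi$ and $\deg_F(\phi^{ -1}(v)):=0$ for vertices $v$ not in the image of $\phi$. -}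

module Defs where

open import Data.Bool using (Bool; true; false; _∧_; _∨_; not; if_then_else_)
open import Data.Nat using (ℕ; zero; suc; _+_; _∸_; _≤_)
open import Data.Fin using (Fin; zero; suc; _≟_)
open import Data.Maybe using (Maybe; just; nothing; is-just)
open import Data.Product using (_×_)
open import Relation.Nullary.Decidable using (⌊_⌋)
open import Relation.Binary.PropositionalEquality using (_≡_; _≢_)

Subset : ℕ → Set
Subset m = Fin m → Bool

count : ∀ {m} → Subset m → ℕ
count {zero}  A = 0
count {suc m} A = (if A zero then 1 else 0) + count (λ i → A (suc i))

sumOver : ∀ {m} → Subset m → (Fin m → ℕ) → ℕ
sumOver {zero}  A f = 0
sumOver {suc m} A f =
  (if A zero then f zero else 0) + sumOver (λ i → A (suc i)) (λ i → f (suc i))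

anyFin : ∀ {m} → (Fin m → Bool) → Bool
anyFin {zero}  P = false
anyFin {suc m} P = P zero ∨ anyFin (λ i → P (suc i))

findFin : ∀ {m} → (Fin m → Bool) → Maybe (Fin m)
findFin {zero}  P = nothing
findFin {suc m} P with P zero
... | true  = just zero
... | false with findFin (λ i → P (suc i))
...   | just i  = just (suc i)
...   | nothing = nothing

_==ᶠ_ : ∀ {m} → Fin m → Fin m → Bool
u ==ᶠ v = ⌊ u ≟ v ⌋

-- A (finite, simple) bipartite graph with a fixed bipartition:
-- vertices Fin m, `side v = false` means v ∈ V₁, `side v = true` means v ∈ V₂.

record BipGraph (m : ℕ) : Set where
  field
    adj   : Fin m → Fin m → Bool
    sym   : ∀ u v → adj u v ≡ adj v u
    side  : Fin m → Bool
    bip   : ∀ u v → adj u v ≡ true → side u ≢ side v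
open BipGraph public

Part : ∀ {m} → BipGraph m → Bool → Subset m
Part G i v = ⌊ Data.Bool._≟_ (side G v) i ⌋

_⊆_ : ∀ {m} → Subset m → Subset m → Set
X ⊆ Y = ∀ v → X v ≡ true → Y v ≡ true

full : ∀ {m} → Subset m
full _ = true

degIn : ∀ {m} → BipGraph m → Subset m → Fin m → ℕ
degIn F S v = count (λ u → S u ∧ adj F v u)

deg : ∀ {m} → BipGraph m → Fin m → ℕ
deg F v = degIn F full v

nbhd : ∀ {m} → BipGraph m → Subset m → Subset m
nbhd G X v = anyFin (λ u → X u ∧ adj G u v)

IsNDBipartite : ∀ {a} → ℕ → ℕ → BipGraph a → Set
IsNDBipartite n D F =
  (∀ i → count (Part F i) ≤ n) × (∀ v → deg F v ≤ D)

-- Embeddings of F[S] into G via φ (the restriction of φ to S).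
-- The case S = full is an embedding of F itself.

IsEmbeddingOn : ∀ {a b} → BipGraph a → BipGraph b → (Fin a → Fin b) → Subset a → Set
IsEmbeddingOn F G φ S =
  (∀ u v → S u ≡ true → S v ≡ true → φ u ≡ φ v → u ≡ v) ×
  (∀ u v → S u ≡ true → S v ≡ true → adj F u v ≡ true → adj G (φ u) (φ v) ≡ true)

IsEmbedding : ∀ {a b} → BipGraph a → BipGraph b → (Fin a → Fin b) → Set
IsEmbedding F G φ = IsEmbeddingOn F G φ full

preimageOn : ∀ {a b} → (Fin a → Fin b) → Subset a → Fin b → Maybe (Fin a)
preimageOn φ S v = findFin (λ u → S u ∧ (φ u ==ᶠ v))

imageOn : ∀ {a b} → (Fin a → Fin b) → Subset a → Subset b
imageOn φ S v = is-just (preimageOn φ S v)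

-- deg_{F[S]}(φ^{-1}(v)), := 0 if v is not in the image
degPreOn : ∀ {a b} → BipGraph a → (Fin a → Fin b) → Subset a → Fin b → ℕ
degPreOn F φ S v with preimageOn φ S v
... | just u  = degIn F S u
... | nothing = 0

GoodIneqOn : ∀ {a b} → ℕ → ℕ → BipGraph a → BipGraph b → (Fin a → Fin b) → Subset a → Set
GoodIneqOn {a} {b} n D F G φ S =
  ∀ (i : Bool) (X : Subset b) → X ⊆ Part G i → count X ≤ n →
    sumOver X (λ v → D ∸ degPreOn F φ S v) + count (λ v → imageOn φ S v ∧ X v)
      ≤ count (λ v → nbhd G X v ∧ not (imageOn φ S v))

IsGoodEmbeddingOn : ∀ {a b} → ℕ → ℕ → BipGraph a → BipGraph b → (Fin a → Fin b) → Subset a → Set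
IsGoodEmbeddingOn n D F G φ S = IsEmbeddingOn F G φ S × GoodIneqOn n D F G φ S

IsGoodEmbedding : ∀ {a b} → ℕ → ℕ → BipGraph a → BipGraph b → (Fin a → Fin b) → Set
IsGoodEmbedding n D F G φ = IsGoodEmbeddingOn n D F G φ full

-- F' = F[S] is obtained from F by successively deleting vertices of
-- degree at most one (degree measured in the current graph).

data ObtainedByLeafDeletion {a} (F : BipGraph a) : Subset a → Set where
  start  : ObtainedByLeafDeletion F full
  delete : ∀ {S} (v : Fin a) → ObtainedByLeafDeletion F S →
           S v ≡ true → degIn F S v ≤ 1 →
           ObtainedByLeafDeletion F (λ u → S u ∧ not (u ==ᶠ v))

-- It suffices to delete a single vertex v of degree at most one from F[S].  Write the
-- good inequality as  Σ_{x ∈ X} demand x ≤ supply X,  where demand x = D − deg(φ⁻¹ x)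
-- + [x ∈ φ(F[S])]  and  supply X = |N_G(X) ∖ φ(F[S])|.  Deleting v lowers the demand at
-- φ(v) from D − deg(v) + 1 ≥ D to D, raises the demand at φ(p) by at most one and only if
-- p is a neighbour of v, and leaves all other demands unchanged.  So if v is isolated nothing
-- grows, and otherwise only the demand at φ(u), for the unique neighbour u, grows; but
-- when φ(u) ∈ X, the vertex φ(v) is a neighbour of X that has just left the image, so
-- the supply grows by one as well.

module Submission where

open import Defs
open import Data.Bool using (Bool; true; false; _∧_; not; if_then_else_)
open import Data.Bool.Properties using (∧-zeroʳ)
open import Data.Empty using (⊥-elim)
open import Data.Fin using (Fin; zero; suc)
open import Data.Fin.Properties using (_≟_; suc-injective)
open import Data.Maybe using (just; nothing; is-just)
open import Data.Nat using (ℕ; zero; suc; _+_; _∸_; _≤_; z≤n; s≤s; s≤s⁻¹)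
open import Data.Nat.Properties
  using (≤-refl; ≤-trans; ≤-reflexive; +-mono-≤; +-monoˡ-≤; +-monoʳ-≤; +-assoc; +-comm; +-suc;
         +-identityʳ; m≤m+n; m≤n+m; m≤n+m∸n; m≤n+o⇒m∸n≤o; +-commutativeSemigroup; module ≤-Reasoning)
open import Algebra.Properties.CommutativeSemigroup +-commutativeSemigroup using (interchange; xy∙z≈xz∙y)
open import Data.Product using (_×_; _,_; proj₁; proj₂; ∃-syntax)
open import Data.Sum using (_⊎_; inj₁; inj₂)
open import Function using (_∘_)
open import Relation.Nullary using (yes; no)
open import Relation.Nullary.Decidable using (isYes≗does; dec-true; dec-false)
open import Relation.Binary.PropositionalEquality
  using (_≡_; _≢_; refl; trans; cong; cong₂; subst; module ≡-Reasoning)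
import Relation.Binary.PropositionalEquality as ≡

indicator : Bool → ℕ
indicator b = if b then 1 else 0

indicator-mono : ∀ {x y} → (x ≡ true → y ≡ true) → indicator x ≤ indicator y
indicator-mono {false} _   = z≤n
indicator-mono {true}  x⇒y rewrite x⇒y refl = ≤-refl

∧-trueˡ : ∀ {x y} → x ∧ y ≡ true → x ≡ true
∧-trueˡ {true} _ = refl

∧-trueʳ : ∀ {x y} → x ∧ y ≡ true → y ≡ true
∧-trueʳ {true} y≡true = y≡true

∧-true : ∀ {x y} → x ≡ true → y ≡ true → x ∧ y ≡ true
∧-true refl refl = refl

not-antitone : ∀ {x y} → (x ≡ true → y ≡ true) → not y ≡ true → not x ≡ true
not-antitone {false} _ _ = refl
not-antitone {true} {false} x⇒y _ with () ← x⇒y refl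

==ᶠ-refl : ∀ {m} (u : Fin m) → (u ==ᶠ u) ≡ true
==ᶠ-refl u = trans (isYes≗does (u ≟ u)) (dec-true (u ≟ u) refl)

==ᶠ⇒≡ : ∀ {m} {u v : Fin m} → (u ==ᶠ v) ≡ true → u ≡ v
==ᶠ⇒≡ {u = u} {v} u==v with u ≟ v
==ᶠ⇒≡ _  | yes u≡v = u≡v
==ᶠ⇒≡ () | no _

≢⇒==ᶠ-false : ∀ {m} {u v : Fin m} → u ≢ v → (u ==ᶠ v) ≡ false
≢⇒==ᶠ-false {u = u} {v} u≢v = trans (isYes≗does (u ≟ v)) (dec-false (u ≟ v) u≢v)

==ᶠ-suc : ∀ {m} (u v : Fin m) → (suc u ==ᶠ suc v) ≡ (u ==ᶠ v)
==ᶠ-suc u v = trans (isYes≗does (suc u ≟ suc v)) (≡.sym (isYes≗does (u ≟ v)))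

∸-≤-∸-+ : ∀ d {m n k} → n ≤ m + k → d ∸ m ≤ d ∸ n + k
∸-≤-∸-+ d {m} {n} {k} n≤m+k = m≤n+o⇒m∸n≤o d m (begin
  d                   ≤⟨ m≤n+m∸n d n ⟩
  n + (d ∸ n)         ≤⟨ +-monoˡ-≤ (d ∸ n) n≤m+k ⟩
  m + k + (d ∸ n)     ≡⟨ +-assoc m k (d ∸ n) ⟩
  m + (k + (d ∸ n))   ≡⟨ cong (m +_) (+-comm k (d ∸ n)) ⟩
  m + (d ∸ n + k)     ∎)
  where open ≤-Reasoning

count-mono : ∀ {m} {A B : Subset m} → A ⊆ B → count A ≤ count B
count-mono {zero}  _   = z≤n
count-mono {suc m} A⊆B = +-mono-≤ (indicator-mono (A⊆B zero)) (count-mono (λ i → A⊆B (suc i)))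

count-mono-< : ∀ {m} {A B : Subset m} (z : Fin m) →
               A ⊆ B → A z ≡ false → B z ≡ true → suc (count A) ≤ count B
count-mono-< {suc m} {A} {B} zero A⊆B Az Bz with A zero | B zero
count-mono-< zero A⊆B refl refl | false | true = s≤s (count-mono (λ i → A⊆B (suc i)))
count-mono-< {suc m} {A} {B} (suc z) A⊆B Az Bz = begin
  suc (indicator (A zero) + count (λ i → A (suc i)))  ≡⟨ ≡.sym (+-suc _ _) ⟩
  indicator (A zero) + suc (count (λ i → A (suc i)))  ≤⟨ +-mono-≤ (indicator-mono (A⊆B zero))
                                                           (count-mono-< z (λ i → A⊆B (suc i)) Az Bz) ⟩
  count B                                             ∎
  where open ≤-Reasoning

count-≤-count-+ : ∀ {m} {A B : Subset m} (z : Fin m) →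
                  (∀ u → A u ≡ true → u ≢ z → B u ≡ true) → count A ≤ count B + indicator (A z)
count-≤-count-+ {suc m} {A} {B} zero A⊆B∪z = begin
  indicator (A zero) + count A⁺               ≤⟨ +-monoʳ-≤ _ (count-mono (λ i Ai → A⊆B∪z (suc i) Ai λ ())) ⟩
  indicator (A zero) + count B⁺               ≡⟨ +-comm (indicator (A zero)) _ ⟩
  count B⁺ + indicator (A zero)               ≤⟨ +-monoˡ-≤ _ (m≤n+m (count B⁺) (indicator (B zero))) ⟩
  count B + indicator (A zero)                ∎
  where
  open ≤-Reasoning
  A⁺ B⁺ : Subset m
  A⁺ i = A (suc i)
  B⁺ i = B (suc i)
count-≤-count-+ {suc m} {A} {B} (suc z) A⊆B∪z = begin
  indicator (A zero) + count A⁺                          ≤⟨ +-mono-≤ (indicator-mono (λ A0 → A⊆B∪z zero A0 λ ()))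
                                                              (count-≤-count-+ z λ i Ai i≢z → A⊆B∪z (suc i) Ai
                                                                                               (i≢z ∘ suc-injective)) ⟩
  indicator (B zero) + (count B⁺ + indicator (A (suc z))) ≡⟨ ≡.sym (+-assoc (indicator (B zero)) _ _) ⟩
  count B + indicator (A (suc z))                        ∎
  where
  open ≤-Reasoning
  A⁺ B⁺ : Subset m
  A⁺ i = A (suc i)
  B⁺ i = B (suc i)

count≤0⇒empty : ∀ {m} {A : Subset m} → count A ≤ 0 → ∀ p → A p ≡ false
count≤0⇒empty {suc m} {A} count≤0 zero with A zero
count≤0⇒empty ()      zero | true
count≤0⇒empty _       zero | false = refl
count≤0⇒empty {suc m} {A} count≤0 (suc p) =
  count≤0⇒empty (≤-trans (m≤n+m _ (indicator (A zero))) count≤0) p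

count≤1⇒empty⊎singleton : ∀ {m} (A : Subset m) → count A ≤ 1 →
  (∀ p → A p ≡ false) ⊎ ∃[ u ] (A u ≡ true × ∀ p → A p ≡ true → p ≡ u)
count≤1⇒empty⊎singleton {zero}  A _ = inj₁ λ ()
count≤1⇒empty⊎singleton {suc m} A count≤1 with A zero in A0
... | true  = inj₂ (zero , A0 , only-zero)
  where
  only-zero : ∀ p → A p ≡ true → p ≡ zero
  only-zero zero    _  = refl
  only-zero (suc p) Ap with () ← trans (≡.sym (count≤0⇒empty (s≤s⁻¹ count≤1) p)) Ap
... | false with count≤1⇒empty⊎singleton (λ i → A (suc i)) count≤1
...   | inj₁ empty = inj₁ λ { zero → A0 ; (suc p) → empty p }
...   | inj₂ (u , Au , unique) = inj₂ (suc u , Au , only-u)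
  where
  only-u : ∀ p → A p ≡ true → p ≡ suc u
  only-u zero    A0′ with () ← trans (≡.sym A0) A0′
  only-u (suc p) Ap  = cong suc (unique p Ap)

sumOver-cong : ∀ {m} (X : Subset m) {f g : Fin m → ℕ} → (∀ v → f v ≡ g v) → sumOver X f ≡ sumOver X g
sumOver-cong {zero}  X f≗g = refl
sumOver-cong {suc m} X f≗g with X zero
... | true  = cong₂ _+_ (f≗g zero) (sumOver-cong (λ i → X (suc i)) (λ i → f≗g (suc i)))
... | false = sumOver-cong (λ i → X (suc i)) (λ i → f≗g (suc i))

sumOver-mono : ∀ {m} (X : Subset m) {f g : Fin m → ℕ} →
               (∀ v → X v ≡ true → f v ≤ g v) → sumOver X f ≤ sumOver X g
sumOver-mono {zero}  X f≤g = z≤n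
sumOver-mono {suc m} X f≤g with X zero in X0
... | true  = +-mono-≤ (f≤g zero X0) (sumOver-mono (λ i → X (suc i)) (λ i → f≤g (suc i)))
... | false = sumOver-mono (λ i → X (suc i)) (λ i → f≤g (suc i))

sumOver-+ : ∀ {m} (X : Subset m) (f g : Fin m → ℕ) →
            sumOver X (λ v → f v + g v) ≡ sumOver X f + sumOver X g
sumOver-+ {zero}  X f g = refl
sumOver-+ {suc m} X f g with X zero
... | true  = trans (cong (f zero + g zero +_) (sumOver-+ (λ i → X (suc i)) (λ i → f (suc i)) (λ i → g (suc i))))
                    (interchange (f zero) (g zero) _ _)
... | false = sumOver-+ (λ i → X (suc i)) (λ i → f (suc i)) (λ i → g (suc i))

sumOver-0 : ∀ {m} (X : Subset m) → sumOver X (λ _ → 0) ≡ 0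
sumOver-0 {zero}  X = refl
sumOver-0 {suc m} X with X zero
... | true  = sumOver-0 (λ i → X (suc i))
... | false = sumOver-0 (λ i → X (suc i))

count-∧≡sumOver-indicator : ∀ {m} (P X : Subset m) →
                            count (λ v → P v ∧ X v) ≡ sumOver X (λ v → indicator (P v))
count-∧≡sumOver-indicator {zero}  P X = refl
count-∧≡sumOver-indicator {suc m} P X with P zero | X zero
... | true  | true  = cong suc (count-∧≡sumOver-indicator (λ i → P (suc i)) (λ i → X (suc i)))
... | true  | false = count-∧≡sumOver-indicator (λ i → P (suc i)) (λ i → X (suc i))
... | false | true  = count-∧≡sumOver-indicator (λ i → P (suc i)) (λ i → X (suc i))
... | false | false = count-∧≡sumOver-indicator (λ i → P (suc i)) (λ i → X (suc i))

sumOver-indicator-==ᶠ : ∀ {m} (X : Subset m) (y : Fin m) →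
                        sumOver X (λ x → indicator (x ==ᶠ y)) ≡ indicator (X y)
sumOver-indicator-==ᶠ {suc m} X zero with X zero
... | true  = cong suc (sumOver-0 (λ i → X (suc i)))
... | false = sumOver-0 (λ i → X (suc i))
sumOver-indicator-==ᶠ {suc m} X (suc y) = begin
  (if X zero then 0 else 0) + sumOver X⁺ (λ i → indicator (suc i ==ᶠ suc y))
    ≡⟨ cong₂ _+_ (if-same (X zero)) (sumOver-cong X⁺ λ i → cong indicator (==ᶠ-suc i y)) ⟩
  0 + sumOver X⁺ (λ i → indicator (i ==ᶠ y))
    ≡⟨ sumOver-indicator-==ᶠ X⁺ y ⟩
  indicator (X (suc y)) ∎
  where
  open ≡-Reasoning
  X⁺ : Subset m
  X⁺ i = X (suc i)
  if-same : ∀ b → (if b then 0 else 0) ≡ 0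
  if-same true  = refl
  if-same false = refl

anyFin-intro : ∀ {m} (P : Fin m → Bool) (z : Fin m) → P z ≡ true → anyFin P ≡ true
anyFin-intro P zero    Pz rewrite Pz = refl
anyFin-intro P (suc z) Pz with P zero
... | true  = refl
... | false = anyFin-intro (λ i → P (suc i)) z Pz

findFin-sound : ∀ {m} (P : Fin m → Bool) {p : Fin m} → findFin P ≡ just p → P p ≡ true
findFin-sound {suc m} P found with P zero in P0
findFin-sound {suc m} P refl | true = P0
... | false with findFin (λ i → P (suc i)) in found⁺
findFin-sound {suc m} P refl | false | just i = findFin-sound (λ i → P (suc i)) found⁺

findFin-nothing : ∀ {m} (P : Fin m → Bool) → findFin P ≡ nothing → ∀ p → P p ≡ false
findFin-nothing {suc m} P none p with P zero in P0
findFin-nothing {suc m} P () p | true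
... | false with findFin (λ i → P (suc i)) in none⁺
findFin-nothing {suc m} P () p       | false | just i
findFin-nothing {suc m} P _  zero    | false | nothing = P0
findFin-nothing {suc m} P _  (suc p) | false | nothing = findFin-nothing (λ i → P (suc i)) none⁺ p

module _ {a b : ℕ} (φ : Fin a → Fin b) where

  InjectiveOn : Subset a → Set
  InjectiveOn T = ∀ u v → T u ≡ true → T v ≡ true → φ u ≡ φ v → u ≡ v

  preimageOn-sound : ∀ {T x p} → preimageOn φ T x ≡ just p → T p ≡ true × φ p ≡ x
  preimageOn-sound {T} {x} found = ∧-trueˡ Pp , ==ᶠ⇒≡ (∧-trueʳ Pp)
    where Pp = findFin-sound (λ u → T u ∧ (φ u ==ᶠ x)) found

  preimageOn-∈ : ∀ {T p} → T p ≡ true → preimageOn φ T (φ p) ≢ nothing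
  preimageOn-∈ {T} {p} Tp none with () ←
    trans (≡.sym (findFin-nothing (λ u → T u ∧ (φ u ==ᶠ φ p)) none p)) (∧-true Tp (==ᶠ-refl (φ p)))

  preimageOn-φ : ∀ {T p} → InjectiveOn T → T p ≡ true → preimageOn φ T (φ p) ≡ just p
  preimageOn-φ {T} {p} injT Tp with preimageOn φ T (φ p) in found
  ... | just q  = cong just (injT q p (proj₁ (preimageOn-sound found)) Tp (proj₂ (preimageOn-sound found)))
  ... | nothing = ⊥-elim (preimageOn-∈ Tp found)

  preimageOn-miss : ∀ {T x} → (∀ q → T q ≡ true → φ q ≢ x) → preimageOn φ T x ≡ nothing
  preimageOn-miss {T} {x} miss with preimageOn φ T x in found
  ... | just q  = ⊥-elim (miss q (proj₁ (preimageOn-sound found)) (proj₂ (preimageOn-sound found)))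
  ... | nothing = refl

  imageOn-φ : ∀ {T p} → T p ≡ true → imageOn φ T (φ p) ≡ true
  imageOn-φ {T} {p} Tp with preimageOn φ T (φ p) in found
  ... | just _  = refl
  ... | nothing = ⊥-elim (preimageOn-∈ Tp found)

  image-cases : ∀ T x → (∃[ p ] T p ≡ true × φ p ≡ x) ⊎ (∀ q → T q ≡ true → φ q ≢ x)
  image-cases T x with preimageOn φ T x in found
  ... | just p  = inj₁ (p , preimageOn-sound found)
  ... | nothing = inj₂ λ { q Tq refl → preimageOn-∈ Tq found }

  imageOn-mono : ∀ {T′ T} → T′ ⊆ T → imageOn φ T′ ⊆ imageOn φ T
  imageOn-mono {T′} T′⊆T x x∈φT′ with image-cases T′ x
  ... | inj₁ (p , T′p , refl) = imageOn-φ (T′⊆T p T′p)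
  ... | inj₂ miss with () ← trans (≡.sym (cong is-just (preimageOn-miss miss))) x∈φT′

IsEmbeddingOn-⊆ : ∀ {a b} {F : BipGraph a} {G : BipGraph b} {φ : Fin a → Fin b} {T′ T : Subset a} →
                  T′ ⊆ T → IsEmbeddingOn F G φ T → IsEmbeddingOn F G φ T′
IsEmbeddingOn-⊆ T′⊆T (injT , adjT) =
  (λ u v T′u T′v → injT u v (T′⊆T u T′u) (T′⊆T v T′v)) ,
  (λ u v T′u T′v → adjT u v (T′⊆T u T′u) (T′⊆T v T′v))

module _ {a b : ℕ} (n D : ℕ) (F : BipGraph a) (G : BipGraph b) (φ : Fin a → Fin b) where

  demand : Subset a → Fin b → ℕ
  demand T x = D ∸ degPreOn F φ T x + indicator (imageOn φ T x)

  supply : Subset a → Subset b → ℕ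
  supply T X = count (λ x → nbhd G X x ∧ not (imageOn φ T x))

  sumOver-demand : ∀ T X → sumOver X (demand T) ≡
    sumOver X (λ x → D ∸ degPreOn F φ T x) + count (λ x → imageOn φ T x ∧ X x)
  sumOver-demand T X = begin
    sumOver X (demand T)
      ≡⟨ sumOver-+ X (λ x → D ∸ degPreOn F φ T x) (λ x → indicator (imageOn φ T x)) ⟩
    sumOver X (λ x → D ∸ degPreOn F φ T x) + sumOver X (λ x → indicator (imageOn φ T x))
      ≡⟨ cong (sumOver X (λ x → D ∸ degPreOn F φ T x) +_) (≡.sym (count-∧≡sumOver-indicator (imageOn φ T) X)) ⟩
    sumOver X (λ x → D ∸ degPreOn F φ T x) + count (λ x → imageOn φ T x ∧ X x) ∎
    where open ≡-Reasoning

  demand-φ : ∀ {T p} → InjectiveOn φ T → T p ≡ true → demand T (φ p) ≡ D ∸ degIn F T p + 1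
  demand-φ injT Tp rewrite preimageOn-φ φ injT Tp = refl

  demand-miss : ∀ {T x} → (∀ q → T q ≡ true → φ q ≢ x) → demand T x ≡ D
  demand-miss miss rewrite preimageOn-miss φ miss = +-identityʳ D

  supply-antitone : ∀ {T T′} X → imageOn φ T′ ⊆ imageOn φ T → supply T X ≤ supply T′ X
  supply-antitone X φT′⊆φT = count-mono λ x h → ∧-true (∧-trueˡ h) (not-antitone (φT′⊆φT x) (∧-trueʳ h))

  supply-antitone-< : ∀ {T T′} X w → imageOn φ T′ ⊆ imageOn φ T →
    nbhd G X w ≡ true → imageOn φ T w ≡ true → imageOn φ T′ w ≡ false → suc (supply T X) ≤ supply T′ X
  supply-antitone-< X w φT′⊆φT w∈NX w∈φT w∉φT′ =
    count-mono-< w (λ x h → ∧-true (∧-trueˡ h) (not-antitone (φT′⊆φT x) (∧-trueʳ h)))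
      (trans (cong (λ t → nbhd G X w ∧ not t) w∈φT) (∧-zeroʳ (nbhd G X w)))
      (∧-true w∈NX (cong not w∉φT′))

  goodIneqOn-transfer : ∀ {T T′} (e : Fin b → ℕ) →
    (∀ x → demand T′ x ≤ demand T x + e x) →
    (∀ X → sumOver X e + supply T X ≤ supply T′ X) →
    GoodIneqOn n D F G φ T → GoodIneqOn n D F G φ T′
  goodIneqOn-transfer {T} {T′} e demand≤ supply≥ goodT i X X⊆Vᵢ |X|≤n = begin
    sumOver X (λ x → D ∸ degPreOn F φ T′ x) + count (λ x → imageOn φ T′ x ∧ X x)
                                           ≡⟨ ≡.sym (sumOver-demand T′ X) ⟩
    sumOver X (demand T′)                  ≤⟨ sumOver-mono X (λ x _ → demand≤ x) ⟩
    sumOver X (λ x → demand T x + e x)     ≡⟨ sumOver-+ X (demand T) e ⟩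
    sumOver X (demand T) + sumOver X e     ≡⟨ cong (_+ sumOver X e) (sumOver-demand T X) ⟩
    _ + sumOver X e                        ≤⟨ +-monoˡ-≤ (sumOver X e) (goodT i X X⊆Vᵢ |X|≤n) ⟩
    supply T X + sumOver X e               ≡⟨ +-comm (supply T X) (sumOver X e) ⟩
    sumOver X e + supply T X               ≤⟨ supply≥ X ⟩
    supply T′ X                            ∎
    where open ≤-Reasoning

  module _ {S : Subset a} (v : Fin a) (Sv : S v ≡ true) (degv≤1 : degIn F S v ≤ 1) where

    S′ : Subset a
    S′ u = S u ∧ not (u ==ᶠ v)

    private
      Nv : Subset a
      Nv u = S u ∧ adj F v u

      S′⊆S : S′ ⊆ S
      S′⊆S _ = ∧-trueˡ

      S′-intro : ∀ {u} → S u ≡ true → u ≢ v → S′ u ≡ true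
      S′-intro Su u≢v = ∧-true Su (cong not (≢⇒==ᶠ-false u≢v))

      S′∌v : ∀ u → S′ u ≡ true → u ≢ v
      S′∌v u S′u refl with () ← trans (≡.sym (cong not (==ᶠ-refl v))) (∧-trueʳ S′u)

      adj-Nv : ∀ {p} → S p ≡ true → adj F p v ≡ Nv p
      adj-Nv {p} Sp = trans (sym F p v) (cong (_∧ adj F v p) (≡.sym Sp))

      degIn-delete : ∀ p → degIn F S p ≤ degIn F S′ p + indicator (adj F p v)
      degIn-delete p = subst (λ t → degIn F S p ≤ degIn F S′ p + indicator (t ∧ adj F p v)) Sv
        (count-≤-count-+ v λ u h u≢v → ∧-true (S′-intro (∧-trueˡ h) u≢v) (∧-trueʳ h))

      module _ (injS : InjectiveOn φ S) where

        φv∉φS′ : ∀ q → S′ q ≡ true → φ q ≢ φ v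
        φv∉φS′ q S′q φq≡φv = S′∌v q S′q (injS q v (S′⊆S q S′q) Sv φq≡φv)

        φv∉imageS′ : imageOn φ S′ (φ v) ≡ false
        φv∉imageS′ = cong is-just (preimageOn-miss φ φv∉φS′)

        demand-delete : (e : Fin b → ℕ) → (∀ p → S p ≡ true → p ≢ v → indicator (adj F p v) ≤ e (φ p)) →
                        ∀ x → demand S′ x ≤ demand S x + e x
        demand-delete e e-bound x with image-cases φ S x
        ... | inj₂ miss = begin
          demand S′ x          ≡⟨ demand-miss (λ q S′q → miss q (S′⊆S q S′q)) ⟩
          D                    ≡⟨ ≡.sym (demand-miss miss) ⟩
          demand S x           ≤⟨ m≤m+n _ (e x) ⟩
          demand S x + e x     ∎
          where open ≤-Reasoning
        ... | inj₁ (p , Sp , refl) with p ≟ v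
        ...   | yes refl = begin
          demand S′ (φ v)             ≡⟨ demand-miss φv∉φS′ ⟩
          D                           ≤⟨ ∸-≤-∸-+ D {m = 0} degv≤1 ⟩
          D ∸ degIn F S v + 1         ≡⟨ ≡.sym (demand-φ injS Sv) ⟩
          demand S (φ v)              ≤⟨ m≤m+n _ (e (φ v)) ⟩
          demand S (φ v) + e (φ v)    ∎
          where open ≤-Reasoning
        ...   | no p≢v = begin
          demand S′ (φ p)                                ≡⟨ demand-φ (λ u w S′u S′w → injS u w (S′⊆S u S′u) (S′⊆S w S′w))
                                                                      (S′-intro Sp p≢v) ⟩
          D ∸ degIn F S′ p + 1                           ≤⟨ +-monoˡ-≤ 1 (∸-≤-∸-+ D (degIn-delete p)) ⟩
          D ∸ degIn F S p + indicator (adj F p v) + 1    ≤⟨ +-monoˡ-≤ 1 (+-monoʳ-≤ _ (e-bound p Sp p≢v)) ⟩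
          D ∸ degIn F S p + e (φ p) + 1                  ≡⟨ xy∙z≈xz∙y _ (e (φ p)) 1 ⟩
          D ∸ degIn F S p + 1 + e (φ p)                  ≡⟨ cong (_+ e (φ p)) (≡.sym (demand-φ injS Sp)) ⟩
          demand S (φ p) + e (φ p)                       ∎
          where open ≤-Reasoning

        φS′⊆φS : imageOn φ S′ ⊆ imageOn φ S
        φS′⊆φS = imageOn-mono φ S′⊆S

        goodIneqOn-deleteIsolated : (∀ p → Nv p ≡ false) → GoodIneqOn n D F G φ S → GoodIneqOn n D F G φ S′
        goodIneqOn-deleteIsolated isolated = goodIneqOn-transfer (λ _ → 0)
          (demand-delete (λ _ → 0) λ p Sp _ → ≤-reflexive (cong indicator (trans (adj-Nv Sp) (isolated p))))
          (λ X → subst (λ s → s + supply S X ≤ supply S′ X) (≡.sym (sumOver-0 X)) (supply-antitone X φS′⊆φS))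

        goodIneqOn-deleteLeaf : ∀ u → Nv u ≡ true → (∀ p → Nv p ≡ true → p ≡ u) →
          (∀ p q → S p ≡ true → S q ≡ true → adj F p q ≡ true → adj G (φ p) (φ q) ≡ true) →
          GoodIneqOn n D F G φ S → GoodIneqOn n D F G φ S′
        goodIneqOn-deleteLeaf u Nvu unique adjS = goodIneqOn-transfer e (demand-delete e e-bound) supply-gain
          where
          e : Fin b → ℕ
          e x = indicator (x ==ᶠ φ u)

          e-bound : ∀ p → S p ≡ true → p ≢ v → indicator (adj F p v) ≤ e (φ p)
          e-bound p Sp _ = indicator-mono λ pv →
            subst (λ q → (φ q ==ᶠ φ u) ≡ true) (≡.sym (unique p (trans (≡.sym (adj-Nv Sp)) pv))) (==ᶠ-refl (φ u))

          gain : ∀ X → indicator (X (φ u)) + supply S X ≤ supply S′ X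
          gain X with X (φ u) in Xφu
          ... | false = supply-antitone X φS′⊆φS
          ... | true  = supply-antitone-< X (φ v) φS′⊆φS
            (anyFin-intro (λ z → X z ∧ adj G z (φ v)) (φ u)
              (∧-true Xφu (adjS u v (∧-trueˡ Nvu) Sv (trans (adj-Nv (∧-trueˡ Nvu)) Nvu))))
            (imageOn-φ φ Sv) φv∉imageS′

          supply-gain : ∀ X → sumOver X e + supply S X ≤ supply S′ X
          supply-gain X = subst (λ s → s + supply S X ≤ supply S′ X)
                                (≡.sym (sumOver-indicator-==ᶠ X (φ u))) (gain X)

    IsGoodEmbeddingOn-deleteLeaf : IsGoodEmbeddingOn n D F G φ S → IsGoodEmbeddingOn n D F G φ S′
    IsGoodEmbeddingOn-deleteLeaf ((injS , adjS) , goodS) = IsEmbeddingOn-⊆ {F = F} {G = G} S′⊆S (injS , adjS) , goodS′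
      where
      goodS′ : GoodIneqOn n D F G φ S′
      goodS′ with count≤1⇒empty⊎singleton Nv degv≤1
      ... | inj₁ isolated           = goodIneqOn-deleteIsolated injS isolated goodS
      ... | inj₂ (u , Nvu , unique) = goodIneqOn-deleteLeaf injS u Nvu unique adjS goodS

lemma2p5 : ∀ (n D : ℕ) → 1 ≤ n → 1 ≤ D
    → {a b : ℕ} (G : BipGraph b) (F : BipGraph a)
    → IsNDBipartite n D F
    → (φ : Fin a → Fin b)
    → IsGoodEmbedding n D F G φ
    → (S : Subset a) → ObtainedByLeafDeletion F S
    → IsGoodEmbeddingOn n D F G φ S
lemma2p5 n D _ _ G F _ φ good .full start = good
lemma2p5 n D 1≤n 1≤D G F nd φ good _ (delete v F↝S Sv degv≤1) =
  IsGoodEmbeddingOn-deleteLeaf n D F G φ v Sv degv≤1 (lemma2p5 n D 1≤n 1≤D G F nd φ good _ F↝S)
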